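{- For every $\mathcal{L}_\mathsf{PAL}$-formula $\varphi$, every label $x$, and all finite multisets $\Gamma,\Delta$ of relational atoms and labelled formulas, the sequent $x:\varphi,\Gamma \Rightarrow \Delta, x:\varphi$ is derivable in $G_\mathsf{PAL}$.
   Context: Fix a denumerable set $\mathsf{Prop}$ of propositional variables and a finite set $\mathsf{Ag}$ of agents. $\mathcal{L}_\mathsf{PAL}$-formulas are given by $\varphi ::= p \mid \neg\varphi \mid \varphi\land\varphi \mid \varphi\to\varphi \mid K_a\varphi \mid [\varphi]\varphi$ with $p\in\mathsf{Prop}$, $a\in\mathsf{Ag}$; $\mathcal{L}_\mathsf{EL}$ is the fragment without $[\cdot]$. Fix a countable set of labels $x,y,z,\dots$. A relational atom is $x\sim_a y$; a labelled formula is $x:\varphi$. A labelled sequent $\Gamma\Rightarrow\Delta$ has $\Gamma,\Delta$ finite multisets of relational atoms and labelled formulas. The calculus $G_\mathsf{EL}$ has initial sequents $x:p,\Gamma\Rightarrow\Delta,x:p$ and $x\sim_ay,\Gamma\Rightarrow\Delta,x\sim_ay$ and the rules: $(\neg\Rightarrow)\ \frac{\Gamma\Rightarrow\Delta,x:\varphi}{x:\neg\varphi,\Gamma\Rightarrow\Delta}$; $(\Rightarrow\neg)\ \frac{x:\varphi,\Gamma\Rightarrow\Delta}{\Gamma\Rightarrow\Delta,x:\neg\varphi}$; $(\land\Rightarrow)\ \frac{x:\varphi_1,x:\varphi_2,\Gamma\Rightarrow\Delta}{x:\varphi_1\land\varphi_2,\Gamma\Rightarrow\Delta}$; $(\Rightarrow\land)\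 \frac{\Gamma\Rightarrow\Delta,x:\varphi_1\quad \Gamma\Rightarrow\Delta,x:\varphi_2}{\Gamma\Rightarrow\Delta,x:\varphi_1\land\varphi_2}$; $(\to\Rightarrow)\ \frac{\Gamma\Rightarrow\Delta,x:\varphi\quad x:\psi,\Gamma\Rightarrow\Delta}{x:\varphi\to\psi,\Gamma\Rightarrow\Delta}$; $(\Rightarrow\to)\ \frac{x:\varphi,\Gamma\Rightarrow\Delta,x:\psi}{\Gamma\Rightarrow\Delta,x:\varphi\to\psi}$; $(K_a\Rightarrow)\ \frac{y:\varphi,x:K_a\varphi,x\sim_ay,\Gamma\Rightarrow\Delta}{x:K_a\varphi,x\sim_ay,\Gamma\Rightarrow\Delta}$; $(\Rightarrow K_a)\ \frac{x\sim_ay,\Gamma\Rightarrow\Delta,y:\varphi}{\Gamma\Rightarrow\Delta,x:K_a\varphi}$ with $y$ not occurring in the conclusion; $(\mathrm{Ref}_a)\ \frac{x\sim_ax,\Gamma\Rightarrow\Delta}{\Gamma\Rightarrow\Delta}$; $(\mathrm{Trans}_a)\ \frac{x\sim_az,x\sim_ay,y\sim_az,\Gamma\Rightarrow\Delta}{x\sim_ay,y\sim_az,\Gamma\Rightarrow\Delta}$; $(\mathrm{Sym}_a)\ \frac{y\sim_ax,x\sim_ay,\Gamma\Rightarrow\Delta}{x\sim_ay,\Gamma\Rightarrow\Delta}$. $G_\mathsf{PAL}$ is $G_\mathsf{EL}$ (with formulas ranging over $\mathcal{L}_\mathsf{PAL}$) plus the reduction rules: $(R1\Rightarrow)\ \frac{\Gamma\Rightarrow\Delta,x:\varphi\quad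 x:p,\Gamma\Rightarrow\Delta}{x:[\varphi]p,\Gamma\Rightarrow\Delta}$; $(\Rightarrow R1)\ \frac{x:\varphi,\Gamma\Rightarrow\Delta,x:p}{\Gamma\Rightarrow\Delta,x:[\varphi]p}$; $(R2\Rightarrow)\ \frac{\Gamma\Rightarrow\Delta,x:\varphi\quad x:\neg[\varphi]\psi,\Gamma\Rightarrow\Delta}{x:[\varphi]\neg\psi,\Gamma\Rightarrow\Delta}$; $(\Rightarrow R2)\ \frac{x:\varphi,\Gamma\Rightarrow\Delta,x:\neg[\varphi]\psi}{\Gamma\Rightarrow\Delta,x:[\varphi]\neg\psi}$; $(R3\Rightarrow)\ \frac{x:[\varphi]\psi_1,x:[\varphi]\psi_2,\Gamma\Rightarrow\Delta}{x:[\varphi](\psi_1\land\psi_2),\Gamma\Rightarrow\Delta}$; $(\Rightarrow R3)\ \frac{\Gamma\Rightarrow\Delta,x:[\varphi]\psi_1\quad\Gamma\Rightarrow\Delta,x:[\varphi]\psi_2}{\Gamma\Rightarrow\Delta,x:[\varphi](\psi_1\land\psi_2)}$; $(R4\Rightarrow)\ \frac{\Gamma\Rightarrow\Delta,x:[\varphi]\psi_1\quad x:[\varphi]\psi_2,\Gamma\Rightarrow\Delta}{x:[\varphi](\psi_1\to\psi_2),\Gamma\Rightarrow\Delta}$; $(\Rightarrow R4)\ \frac{x:[\varphi]\psi_1,\Gamma\Rightarrow\Delta,x:[\varphi]\psi_2}{\Gamma\Rightarrow\Delta,x:[\varphi](\psi_1\to\psi_2)}$; $(R5\Rightarrow)\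 \frac{\Gamma\Rightarrow\Delta,x:\varphi\quad x:K_a[\varphi]\psi,\Gamma\Rightarrow\Delta}{x:[\varphi]K_a\psi,\Gamma\Rightarrow\Delta}$; $(\Rightarrow R5)\ \frac{x:\varphi,\Gamma\Rightarrow\Delta,x:K_a[\varphi]\psi}{\Gamma\Rightarrow\Delta,x:[\varphi]K_a\psi}$; $(R6\Rightarrow)\ \frac{x:[\varphi\land[\varphi]\psi]\chi,\Gamma\Rightarrow\Delta}{x:[\varphi][\psi]\chi,\Gamma\Rightarrow\Delta}$; $(\Rightarrow R6)\ \frac{\Gamma\Rightarrow\Delta,x:[\varphi\land[\varphi]\psi]\chi}{\Gamma\Rightarrow\Delta,x:[\varphi][\psi]\chi}$. Derivations are finite trees built from these rules with initial sequents at the leaves. -}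

module Defs where

open import Data.Nat using (ℕ)
open import Data.Fin using (Fin)
open import Data.List using (List; []; _∷_)
open import Data.List.Relation.Binary.Permutation.Propositional using (_↭_)
open import Data.List.Membership.Propositional using (_∈_)
open import Relation.Nullary using (¬_)
open import Relation.Binary.PropositionalEquality using (_≡_)
open import Data.Product using (∃; _×_)

Var : Set
Var = ℕ

Label : Set
Label = ℕ

data Form (m : ℕ) : Set where
  atom : Var → Form m
  ¬'   : Form m → Form m
  _∧'_ : Form m → Form m → Form m
  _⇒'_ : Form m → Form m → Form m
  K    : Fin m → Form m → Form m
  [_]_ : Form m → Form m → Form m

data Item (m : ℕ) : Set where
  rel : Label → Fin m → Label → Item m
  lab : Label → Form m → Item m

data OccursIn {m : ℕ} (z : Label) : Item m → Set where
  relˡ : ∀ {a y} → OccursIn z (rel z a y)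
  relʳ : ∀ {x a} → OccursIn z (rel x a z)
  labo : ∀ {φ} → OccursIn z (lab z φ)

OccursL : ∀ {m} → Label → List (Item m) → Set
OccursL z Γ = ∃ λ i → (i ∈ Γ) × OccursIn z i

-- Sequents Γ ⇒ Δ with Γ, Δ finite multisets, represented as lists
-- together with the exchange rule `perm` (closure under permutation),
-- so that derivability only depends on the underlying multisets.
infix 3 _⊢_
data _⊢_ {m : ℕ} : List (Item m) → List (Item m) → Set where
  perm : ∀ {Γ Γ' Δ Δ'} → Γ ↭ Γ' → Δ ↭ Δ' → Γ ⊢ Δ → Γ' ⊢ Δ'
  init-p : ∀ {x p Γ Δ} → lab x (atom p) ∷ Γ ⊢ lab x (atom p) ∷ Δ
  init-r : ∀ {x a y Γ Δ} → rel x a y ∷ Γ ⊢ rel x a y ∷ Δ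
  ¬L : ∀ {x φ Γ Δ} → Γ ⊢ lab x φ ∷ Δ → lab x (¬' φ) ∷ Γ ⊢ Δ
  ¬R : ∀ {x φ Γ Δ} → lab x φ ∷ Γ ⊢ Δ → Γ ⊢ lab x (¬' φ) ∷ Δ
  ∧L : ∀ {x φ ψ Γ Δ} → lab x φ ∷ lab x ψ ∷ Γ ⊢ Δ → lab x (φ ∧' ψ) ∷ Γ ⊢ Δ
  ∧R : ∀ {x φ ψ Γ Δ} → Γ ⊢ lab x φ ∷ Δ → Γ ⊢ lab x ψ ∷ Δ → Γ ⊢ lab x (φ ∧' ψ) ∷ Δ
  ⇒L : ∀ {x φ ψ Γ Δ} → Γ ⊢ lab x φ ∷ Δ → lab x ψ ∷ Γ ⊢ Δ → lab x (φ ⇒' ψ) ∷ Γ ⊢ Δ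
  ⇒R : ∀ {x φ ψ Γ Δ} → lab x φ ∷ Γ ⊢ lab x ψ ∷ Δ → Γ ⊢ lab x (φ ⇒' ψ) ∷ Δ
  KL : ∀ {x y a φ Γ Δ} → lab y φ ∷ lab x (K a φ) ∷ rel x a y ∷ Γ ⊢ Δ
       → lab x (K a φ) ∷ rel x a y ∷ Γ ⊢ Δ
  KR : ∀ {x y a φ Γ Δ} → ¬ (y ≡ x) → ¬ OccursL y Γ → ¬ OccursL y Δ
       → rel x a y ∷ Γ ⊢ lab y φ ∷ Δ → Γ ⊢ lab x (K a φ) ∷ Δ
  Ref   : ∀ {x a Γ Δ} → rel x a x ∷ Γ ⊢ Δ → Γ ⊢ Δ
  Trans : ∀ {x y z a Γ Δ} → rel x a z ∷ rel x a y ∷ rel y a z ∷ Γ ⊢ Δ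
          → rel x a y ∷ rel y a z ∷ Γ ⊢ Δ
  Sym   : ∀ {x y a Γ Δ} → rel y a x ∷ rel x a y ∷ Γ ⊢ Δ → rel x a y ∷ Γ ⊢ Δ
  R1L : ∀ {x φ p Γ Δ} → Γ ⊢ lab x φ ∷ Δ → lab x (atom p) ∷ Γ ⊢ Δ
        → lab x ([ φ ] atom p) ∷ Γ ⊢ Δ
  R1R : ∀ {x φ p Γ Δ} → lab x φ ∷ Γ ⊢ lab x (atom p) ∷ Δ
        → Γ ⊢ lab x ([ φ ] atom p) ∷ Δ
  R2L : ∀ {x φ ψ Γ Δ} → Γ ⊢ lab x φ ∷ Δ → lab x (¬' ([ φ ] ψ)) ∷ Γ ⊢ Δ
        → lab x ([ φ ] ¬' ψ) ∷ Γ ⊢ Δ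
  R2R : ∀ {x φ ψ Γ Δ} → lab x φ ∷ Γ ⊢ lab x (¬' ([ φ ] ψ)) ∷ Δ
        → Γ ⊢ lab x ([ φ ] ¬' ψ) ∷ Δ
  R3L : ∀ {x φ ψ₁ ψ₂ Γ Δ} → lab x ([ φ ] ψ₁) ∷ lab x ([ φ ] ψ₂) ∷ Γ ⊢ Δ
        → lab x ([ φ ] (ψ₁ ∧' ψ₂)) ∷ Γ ⊢ Δ
  R3R : ∀ {x φ ψ₁ ψ₂ Γ Δ} → Γ ⊢ lab x ([ φ ] ψ₁) ∷ Δ → Γ ⊢ lab x ([ φ ] ψ₂) ∷ Δ
        → Γ ⊢ lab x ([ φ ] (ψ₁ ∧' ψ₂)) ∷ Δ
  R4L : ∀ {x φ ψ₁ ψ₂ Γ Δ} → Γ ⊢ lab x ([ φ ] ψ₁) ∷ Δ → lab x ([ φ ] ψ₂) ∷ Γ ⊢ Δ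
        → lab x ([ φ ] (ψ₁ ⇒' ψ₂)) ∷ Γ ⊢ Δ
  R4R : ∀ {x φ ψ₁ ψ₂ Γ Δ} → lab x ([ φ ] ψ₁) ∷ Γ ⊢ lab x ([ φ ] ψ₂) ∷ Δ
        → Γ ⊢ lab x ([ φ ] (ψ₁ ⇒' ψ₂)) ∷ Δ
  R5L : ∀ {x a φ ψ Γ Δ} → Γ ⊢ lab x φ ∷ Δ → lab x (K a ([ φ ] ψ)) ∷ Γ ⊢ Δ
        → lab x ([ φ ] K a ψ) ∷ Γ ⊢ Δ
  R5R : ∀ {x a φ ψ Γ Δ} → lab x φ ∷ Γ ⊢ lab x (K a ([ φ ] ψ)) ∷ Δ
        → Γ ⊢ lab x ([ φ ] K a ψ) ∷ Δ
  R6L : ∀ {x φ ψ χ Γ Δ} → lab x ([ φ ∧' ([ φ ] ψ) ] χ) ∷ Γ ⊢ Δ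
        → lab x ([ φ ] ([ ψ ] χ)) ∷ Γ ⊢ Δ
  R6R : ∀ {x φ ψ χ Γ Δ} → Γ ⊢ lab x ([ φ ∧' ([ φ ] ψ) ] χ) ∷ Δ
        → Γ ⊢ lab x ([ φ ] ([ ψ ] χ)) ∷ Δ

-- Atomic identities are initial sequents; every other identity is obtained
-- by applying the left and right rule for the principal connective and
-- closing the premises by identities of smaller weight. The reduction rules
-- do not shrink formulas syntactically, but they do decrease the weight
-- w([φ]ψ) = (4 + w φ) · w ψ, so the recursion is well founded on this weight.
-- For K_a a label fresh for the whole sequent serves as eigenvariable.
module Submission where

open import Defs
open import Data.Nat using (ℕ; suc; _+_; _*_; _≤_; _<_; NonZero; s≤s)
open import Data.Nat.Induction using (<-wellFounded)
open import Data.Nat.Properties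
open import Data.Nat.Tactic.RingSolver using (solve-∀)
open import Data.List using (List; []; _∷_)
open import Data.List.Relation.Binary.Permutation.Propositional using (refl; swap)
open import Data.List.Relation.Unary.Any using (here; there)
open import Data.Product using (∃; _×_; _,_)
open import Function using (_on_)
open import Induction.WellFounded using (WellFounded; Acc; acc)
open import Relation.Binary.Construct.On as On using ()
open import Relation.Binary.PropositionalEquality as ≡ using (_≡_)
open import Relation.Nullary using (¬_)

private
  variable
    m : ℕ

weight : Form m → ℕ
weight (atom _)  = 1
weight (¬' φ)    = suc (weight φ)
weight (φ ∧' ψ)  = suc (weight φ + weight ψ)
weight (φ ⇒' ψ)  = suc (weight φ + weight ψ)
weight (K _ φ)   = suc (weight φ)
weight ([ φ ] ψ) = (4 + weight φ) * weight ψ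

weight-nonZero : (φ : Form m) → NonZero (weight φ)
weight-nonZero (atom _)  = _
weight-nonZero (¬' _)    = _
weight-nonZero (_ ∧' _)  = _
weight-nonZero (_ ⇒' _)  = _
weight-nonZero (K _ _)   = _
weight-nonZero ([ φ ] ψ) = m*n≢0 (4 + weight φ) (weight ψ) {{_}} {{weight-nonZero ψ}}

infix 4 _≺_
_≺_ : Form m → Form m → Set
_≺_ = _<_ on weight

≺-wellFounded : WellFounded (_≺_ {m})
≺-wellFounded = On.wellFounded weight <-wellFounded

≺-∧ˡ : (φ ψ : Form m) → φ ≺ φ ∧' ψ
≺-∧ˡ φ ψ = s≤s (m≤m+n (weight φ) (weight ψ))

≺-∧ʳ : (φ ψ : Form m) → ψ ≺ φ ∧' ψ
≺-∧ʳ φ ψ = s≤s (m≤n+m (weight ψ) (weight φ))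

≺-⇒ˡ : (φ ψ : Form m) → φ ≺ φ ⇒' ψ
≺-⇒ˡ φ ψ = s≤s (m≤m+n (weight φ) (weight ψ))

≺-⇒ʳ : (φ ψ : Form m) → ψ ≺ φ ⇒' ψ
≺-⇒ʳ φ ψ = s≤s (m≤n+m (weight ψ) (weight φ))

≺-[]ˡ : (φ ψ : Form m) → φ ≺ [ φ ] ψ
≺-[]ˡ φ ψ = <-≤-trans (s≤s (m≤n+m (weight φ) 3))
                      (m≤m*n (4 + weight φ) (weight ψ) {{weight-nonZero ψ}})

≺-[]-monoʳ : (φ ψ ψ' : Form m) → ψ ≺ ψ' → [ φ ] ψ ≺ [ φ ] ψ'
≺-[]-monoʳ φ _ _ = *-monoʳ-< (4 + weight φ)

1+[4+a]*b<[4+a]*[1+b] : ∀ a b → suc ((4 + a) * b) < (4 + a) * suc b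
1+[4+a]*b<[4+a]*[1+b] a b =
  ≡.subst (suc (suc ((4 + a) * b)) ≤_) (≡.sym (*-suc (4 + a) b))
          (+-monoˡ-≤ ((4 + a) * b) (m≤m+n 2 (2 + a)))

≺-composition : (φ ψ χ : Form m) → [ φ ∧' ([ φ ] ψ) ] χ ≺ [ φ ] ([ ψ ] χ)
≺-composition φ ψ χ =
  ≡.subst (weight ([ φ ∧' ([ φ ] ψ) ] χ) <_) (*-assoc (4 + a) (4 + b) k)
          (*-monoˡ-< k {{weight-nonZero χ}} guard<product)
  where
  a = weight φ
  b = weight ψ
  k = weight χ
  expand : ∀ a b → (4 + a) * (4 + b) ≡ suc (5 + a + (4 + a) * b) + (10 + 3 * a)
  expand = solve-∀
  guard<product : 5 + a + (4 + a) * b < (4 + a) * (4 + b)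
  guard<product = ≡.subst (5 + a + (4 + a) * b <_) (≡.sym (expand a b)) (m≤m+n _ _)

itemLabelBound : Item m → ℕ
itemLabelBound (rel x _ y) = x + y
itemLabelBound (lab x _)   = x

occursIn⇒≤itemLabelBound : ∀ {z} {i : Item m} → OccursIn z i → z ≤ itemLabelBound i
occursIn⇒≤itemLabelBound {i = rel x _ y} relˡ = m≤m+n x y
occursIn⇒≤itemLabelBound {i = rel x _ y} relʳ = m≤n+m y x
occursIn⇒≤itemLabelBound labo                 = ≤-refl

labelBound : List (Item m) → ℕ
labelBound []      = 0
labelBound (i ∷ Γ) = itemLabelBound i + labelBound Γ

occurs⇒≤labelBound : ∀ {z} (Γ : List (Item m)) → OccursL z Γ → z ≤ labelBound Γ
occurs⇒≤labelBound (i ∷ Γ) (_ , here ≡.refl , o) =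
  ≤-trans (occursIn⇒≤itemLabelBound o) (m≤m+n _ (labelBound Γ))
occurs⇒≤labelBound (i ∷ Γ) (j , there j∈Γ , o) =
  ≤-trans (occurs⇒≤labelBound Γ (j , j∈Γ , o)) (m≤n+m (labelBound Γ) _)

freshLabel : (Γ Δ : List (Item m)) → ∃ λ y → ¬ OccursL y Γ × ¬ OccursL y Δ
freshLabel Γ Δ =
  y , (λ o → <-irrefl ≡.refl (≤-trans (s≤s (m≤m+n _ _)) (occurs⇒≤labelBound Γ o)))
    , (λ o → <-irrefl ≡.refl (≤-trans (s≤s (m≤n+m _ _)) (occurs⇒≤labelBound Δ o)))
  where y = suc (labelBound Γ + labelBound Δ)

exchangeˡ : ∀ {i j : Item m} {Γ Δ} → i ∷ j ∷ Γ ⊢ Δ → j ∷ i ∷ Γ ⊢ Δ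
exchangeˡ = perm (swap _ _ refl) refl

identity : (φ : Form m) → Acc _≺_ φ → ∀ x Γ Δ → lab x φ ∷ Γ ⊢ lab x φ ∷ Δ
identity (atom p) _ x Γ Δ = init-p
identity (¬' φ) (acc rec) x Γ Δ =
  ¬R (exchangeˡ (¬L (identity φ (rec ≤-refl) x Γ Δ)))
identity (φ ∧' ψ) (acc rec) x Γ Δ =
  ∧L (∧R (identity φ (rec (≺-∧ˡ φ ψ)) x (lab x ψ ∷ Γ) Δ)
         (exchangeˡ (identity ψ (rec (≺-∧ʳ φ ψ)) x (lab x φ ∷ Γ) Δ)))
identity (φ ⇒' ψ) (acc rec) x Γ Δ =
  ⇒R (exchangeˡ (⇒L (identity φ (rec (≺-⇒ˡ φ ψ)) x Γ (lab x ψ ∷ Δ))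
                    (identity ψ (rec (≺-⇒ʳ φ ψ)) x (lab x φ ∷ Γ) Δ)))
identity (K a φ) (acc rec) x Γ Δ with freshLabel (lab x (K a φ) ∷ Γ) Δ
... | y , y∉Γ , y∉Δ =
  KR y≢x y∉Γ y∉Δ
     (exchangeˡ (KL (identity φ (rec ≤-refl) y (lab x (K a φ) ∷ rel x a y ∷ Γ) Δ)))
  where
  y≢x : ¬ (y ≡ x)
  y≢x ≡.refl = y∉Γ (_ , here ≡.refl , labo)
identity ([ φ ] atom p) (acc rec) x Γ Δ =
  R1R (exchangeˡ (R1L (identity φ (rec (≺-[]ˡ φ (atom p))) x Γ (lab x (atom p) ∷ Δ)) init-p))
identity ([ φ ] ¬' ψ) (acc rec) x Γ Δ =
  R2R (exchangeˡ
    (R2L (identity φ (rec (≺-[]ˡ φ (¬' ψ))) x Γ _)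
         (identity (¬' ([ φ ] ψ)) (rec (1+[4+a]*b<[4+a]*[1+b] (weight φ) (weight ψ))) x _ Δ)))
identity ([ φ ] (ψ₁ ∧' ψ₂)) (acc rec) x Γ Δ =
  R3L (R3R (identity ([ φ ] ψ₁) (rec (≺-[]-monoʳ φ ψ₁ (ψ₁ ∧' ψ₂) (≺-∧ˡ ψ₁ ψ₂))) x _ Δ)
           (exchangeˡ (identity ([ φ ] ψ₂) (rec (≺-[]-monoʳ φ ψ₂ (ψ₁ ∧' ψ₂) (≺-∧ʳ ψ₁ ψ₂))) x _ Δ)))
identity ([ φ ] (ψ₁ ⇒' ψ₂)) (acc rec) x Γ Δ =
  R4R (exchangeˡ
    (R4L (identity ([ φ ] ψ₁) (rec (≺-[]-monoʳ φ ψ₁ (ψ₁ ⇒' ψ₂) (≺-⇒ˡ ψ₁ ψ₂))) x Γ _)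
         (identity ([ φ ] ψ₂) (rec (≺-[]-monoʳ φ ψ₂ (ψ₁ ⇒' ψ₂) (≺-⇒ʳ ψ₁ ψ₂))) x _ Δ)))
identity ([ φ ] K a ψ) (acc rec) x Γ Δ =
  R5R (exchangeˡ
    (R5L (identity φ (rec (≺-[]ˡ φ (K a ψ))) x Γ _)
         (identity (K a ([ φ ] ψ)) (rec (1+[4+a]*b<[4+a]*[1+b] (weight φ) (weight ψ))) x _ Δ)))
identity ([ φ ] ([ ψ ] χ)) (acc rec) x Γ Δ =
  R6R (R6L (identity ([ φ ∧' ([ φ ] ψ) ] χ) (rec (≺-composition φ ψ χ)) x Γ Δ))

mainTheorem1 : ∀ {m : ℕ} (φ : Form m) (x : Label) (Γ Δ : List (Item m)) →
    lab x φ ∷ Γ ⊢ lab x φ ∷ Δ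
mainTheorem1 φ = identity φ (≺-wellFounded φ)
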